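{- Let $m,n$ be integers and let $(x,y,z,t)$ be integers with $m=x^{2}+y^{2}+z^{2}+t^{2}$ and $n=x+y+z+6t$. Suppose at least one of the following holds modulo $3$: $t\equiv z-y$; $t\equiv x-z$; $t\equiv y-x$; $t\equiv y-z$; $t\equiv x-y$; $t\equiv z-x$. Then there exist integers $x',y',z',t'$ with $m=x'^{2}+y'^{2}+z'^{2}+t'^{2}$ and $n=x'+2y'+3z'+5t'$. -}

module Defs where

open import Data.Integer using (ℤ; _-_; _*_; _+_; +_)
open import Data.Integer.Divisibility using (_∣_)

infix 4 _≡₃_
_≡₃_ : ℤ → ℤ → Set
a ≡₃ b = + 3 ∣ (a - b)

sq : ℤ → ℤ
sq a = a * a

{-# OPTIONS --safe #-}
-- If t = y - z + 3j, then the map (x, y, z, t) ↦ (x, y + j - z, 2j - z, y + 2j)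
-- preserves x² + y² + z² + t² and carries x + y + z + 6t to x + 2y + 3z + 5t.
-- Each of the six congruences is this hypothesis up to a permutation of x, y, z,
-- under which both x² + y² + z² and x + y + z are invariant.
module Submission where

open import Defs
open import Data.Integer using (ℤ; _+_; _-_; _*_; +_)
open import Data.Integer.Divisibility.Signed using (divides; ∣ᵤ⇒∣)
open import Data.Integer.Tactic.RingSolver using (solve-∀)
open import Data.Product using (_×_; ∃-syntax; _,_)
open import Function using (_∘_)
open import Data.Sum using (_⊎_; inj₁; inj₂)
open import Relation.Binary.PropositionalEquality using (_≡_; refl; trans; cong; subst₂)

Rep₁₂₃₅ : ℤ → ℤ → Set
Rep₁₂₃₅ m n = ∃[ x′ ] ∃[ y′ ] ∃[ z′ ] ∃[ t′ ]
  ((m ≡ sq x′ + sq y′ + sq z′ + sq t′) × (n ≡ x′ + (+ 2) * y′ + (+ 3) * z′ + (+ 5) * t′))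

record Transferable (x y z t : ℤ) : Set where
  constructor transferred
  field representation : Rep₁₂₃₅ (sq x + sq y + sq z + sq t) (x + y + z + (+ 6) * t)

transferable-swap₁₂ : ∀ {x y z t} → Transferable x y z t → Transferable y x z t
transferable-swap₁₂ {x} {y} {z} {t} (transferred r) =
  transferred (subst₂ Rep₁₂₃₅ (squares x y z t) (linear x y z t) r)
  where
  squares : ∀ x y z t → x * x + y * y + z * z + t * t ≡ y * y + x * x + z * z + t * t
  squares = solve-∀
  linear : ∀ x y z t → x + y + z + (+ 6) * t ≡ y + x + z + (+ 6) * t
  linear = solve-∀

transferable-swap₂₃ : ∀ {x y z t} → Transferable x y z t → Transferable x z y t
transferable-swap₂₃ {x} {y} {z} {t} (transferred r) =
  transferred (subst₂ Rep₁₂₃₅ (squares x y z t) (linear x y z t) r)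
  where
  squares : ∀ x y z t → x * x + y * y + z * z + t * t ≡ x * x + z * z + y * y + t * t
  squares = solve-∀
  linear : ∀ x y z t → x + y + z + (+ 6) * t ≡ x + z + y + (+ 6) * t
  linear = solve-∀

≡₃⇒≡+3* : ∀ {a b} → a ≡₃ b → ∃[ j ] (a ≡ b + j * + 3)
≡₃⇒≡+3* {a} {b} 3∣a-b with ∣ᵤ⇒∣ 3∣a-b
... | divides j a-b≡j*3 = j , trans (rearrange a b) (cong (λ w → b + w) a-b≡j*3)
  where
  rearrange : ∀ a b → a ≡ b + (a - b)
  rearrange = solve-∀

-- Squares are written a * a throughout, since the ring solver does not unfold sq.
sq-sum-shift : ∀ x y z j →
  let t = y - z + j * + 3 ; y′ = y + j - z ; z′ = (+ 2) * j - z ; t′ = y + (+ 2) * j in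
  x * x + y * y + z * z + t * t ≡ x * x + y′ * y′ + z′ * z′ + t′ * t′
sq-sum-shift = solve-∀

linear-shift : ∀ x y z j →
  x + y + z + (+ 6) * (y - z + j * + 3) ≡
  x + (+ 2) * (y + j - z) + (+ 3) * ((+ 2) * j - z) + (+ 5) * (y + (+ 2) * j)
linear-shift = solve-∀

≡₃-difference⇒transferable : ∀ x y z t → t ≡₃ y - z → Transferable x y z t
≡₃-difference⇒transferable x y z t t≡₃y-z with ≡₃⇒≡+3* {t} {y - z} t≡₃y-z
... | j , refl = transferred
  (x , y + j - z , (+ 2) * j - z , y + (+ 2) * j , sq-sum-shift x y z j , linear-shift x y z j)

lemma3p9 : (m n x y z t : ℤ) →
    m ≡ sq x + sq y + sq z + sq t →
    n ≡ x + y + z + (+ 6) * t →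
    (t ≡₃ (z - y)) ⊎ (t ≡₃ (x - z)) ⊎ (t ≡₃ (y - x)) ⊎ (t ≡₃ (y - z)) ⊎ (t ≡₃ (x - y)) ⊎ (t ≡₃ (z - x)) →
    ∃[ x′ ] ∃[ y′ ] ∃[ z′ ] ∃[ t′ ]
    ((m ≡ sq x′ + sq y′ + sq z′ + sq t′) × (n ≡ x′ + (+ 2) * y′ + (+ 3) * z′ + (+ 5) * t′))
lemma3p9 m n x y z t refl refl = Transferable.representation ∘ transfer
  where
  transfer : (t ≡₃ (z - y)) ⊎ (t ≡₃ (x - z)) ⊎ (t ≡₃ (y - x)) ⊎ (t ≡₃ (y - z)) ⊎ (t ≡₃ (x - y)) ⊎ (t ≡₃ (z - x)) →
             Transferable x y z t
  transfer (inj₁ c) = transferable-swap₂₃ (≡₃-difference⇒transferable x z y t c)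
  transfer (inj₂ (inj₁ c)) = transferable-swap₁₂ (≡₃-difference⇒transferable y x z t c)
  transfer (inj₂ (inj₂ (inj₁ c))) =
    (transferable-swap₁₂ ∘ transferable-swap₂₃ ∘ transferable-swap₁₂)
      (≡₃-difference⇒transferable z y x t c)
  transfer (inj₂ (inj₂ (inj₂ (inj₁ c)))) = ≡₃-difference⇒transferable x y z t c
  transfer (inj₂ (inj₂ (inj₂ (inj₂ (inj₁ c))))) =
    (transferable-swap₂₃ ∘ transferable-swap₁₂) (≡₃-difference⇒transferable z x y t c)
  transfer (inj₂ (inj₂ (inj₂ (inj₂ (inj₂ c))))) =
    (transferable-swap₁₂ ∘ transferable-swap₂₃) (≡₃-difference⇒transferable y z x t c)
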